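{- Let $k\ge2$ be an integer and $M$ a matroid. The following are equivalent: (1) $M\in\mathcal E_k$; (2) every $k$-dimensional induced restriction of $M$ has even size; (3) there are matroids $M_0,M_1,\dots,M_s$ and $N_0,\dots,N_{s-1}\in\mathcal E_{k-1}$ such that $\dim(M_0)\le k-1$ and $M_s=M$, while for each $i\in\{0,\dots,s-1\}$, $M_i$ and $N_i$ have the same projective geometry $G(M_i)=G(N_i)$ and $M_{i+1}$ is isomorphic to the twist doubling of $M_i$ with respect to $N_i$.
   Context: A simple binary matroid (here just "matroid") is a pair $M=(E,G)$, where $G$ is identified with $\mathbb F_2^n\setminus\{0\}$ for some $n\ge0$ and $E\subseteq G$; $\dim(M)=n$, $G(M)=G$. A flat of $G$ is a set $V\setminus\{0\}$ with $V$ a subspace, of dimension $\dim V$; a hyperplane is a flat of dimension $n-1$. A $d$-dimensional induced restriction of $M$ is $M|F=(E\cap F,F)$ for a flat $F$ of dimension $d$; its size is $|E\cap F|$. Isomorphism of $(E,G)$ and $(E',G')$ means a bijective linear map $G'\to G$ (on underlying vector spaces) carrying $E'$ onto $E$. For an integer $k$, $\mathcal E_k$ is the class of matroids $(E,G)$ with $|E\cap F|$ even for every flat $F$ of dimension at least $k$. Twist doubling: given $M=(E,G)$ and $N=(D,G)$, let $G'$ be a projective geometry having $G$ as a hyperplane and $w\in G'\setminus G$; the twist doubling of $M$ with respect to $N$ is $(E\cup\{w+x:x\in E\triangle D\},G')$, well defined up to isomorphism. -}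

module Defs where

open import Data.Bool using (Bool; true; false; _∧_; _xor_; not)
open import Data.Nat using (ℕ; zero; suc; _≤_; _∸_; _%_)
open import Data.List using (List; []; _∷_; _++_; map; filter; length)
open import Data.Bool.ListAction using (any)
open import Data.Vec using (Vec; []; _∷_; replicate; zipWith)
open import Data.Product using (Σ; _×_; _,_)
open import Function.Definitions using (Bijective)
open import Relation.Binary.PropositionalEquality using (_≡_)
open import Relation.Nullary using (¬_)
open import Relation.Nullary.Decidable using (T?)

-- The vector space F₂ⁿ, as Vec Bool n (true = 1, _xor_ = addition).

𝟎 : (n : ℕ) → Vec Bool n
𝟎 n = replicate n false

_⊕_ : {n : ℕ} → Vec Bool n → Vec Bool n → Vec Bool n
_⊕_ = zipWith _xor_

_==_ : {n : ℕ} → Vec Bool n → Vec Bool n → Bool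
[] == [] = true
(true ∷ xs) == (true ∷ ys) = xs == ys
(false ∷ xs) == (false ∷ ys) = xs == ys
(true ∷ xs) == (false ∷ ys) = false
(false ∷ xs) == (true ∷ ys) = false

isZero : {n : ℕ} → Vec Bool n → Bool
isZero {n} v = v == 𝟎 n

allVecs : (n : ℕ) → List (Vec Bool n)
allVecs zero = [] ∷ []
allVecs (suc n) = map (false ∷_) (allVecs n) ++ map (true ∷_) (allVecs n)

count : {A : Set} → (A → Bool) → List A → ℕ
count p xs = length (filter (λ x → T? (p x)) xs)

Even : ℕ → Set
Even m = m % 2 ≡ 0

-- Simple binary matroids of dimension n: E ⊆ G = F₂ⁿ ∖ {0}, given by its
-- characteristic function, which must vanish at 0.

record Mat (n : ℕ) : Set where
  field
    E    : Vec Bool n → Bool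
    E-0  : E (𝟎 n) ≡ false
open Mat public

-- Flats.  A flat of dimension d of G = F₂ⁿ∖{0} is V ∖ {0} for a
-- d-dimensional subspace V, i.e. V = span of d linearly independent
-- vectors b₁,…,b_d.

comb : {n d : ℕ} → Vec (Vec Bool n) d → Vec Bool d → Vec Bool n
comb {n} [] [] = 𝟎 n
comb (b ∷ bs) (true ∷ cs) = b ⊕ comb bs cs
comb (b ∷ bs) (false ∷ cs) = comb bs cs

LinIndep : {n d : ℕ} → Vec (Vec Bool n) d → Set
LinIndep {n} {d} B = (c : Vec Bool d) → comb B c ≡ 𝟎 n → c ≡ 𝟎 d

inSpan : {n d : ℕ} → Vec (Vec Bool n) d → Vec Bool n → Bool
inSpan {n} {d} B v = any (λ c → comb B c == v) (allVecs d)

-- size |E ∩ F| of the induced restriction M|F, F = span(B) ∖ {0}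
restrSize : {n d : ℕ} → Mat n → Vec (Vec Bool n) d → ℕ
restrSize {n} M B =
  count (λ v → not (isZero v) ∧ (inSpan B v ∧ E M v)) (allVecs n)

-- the class 𝓔_k : every flat of dimension ≥ k meets E in an even number
InClassE : ℕ → {n : ℕ} → Mat n → Set
InClassE k {n} M =
  (d : ℕ) → k ≤ d → (B : Vec (Vec Bool n) d) → LinIndep B → Even (restrSize M B)

EvenRestrictions : ℕ → {n : ℕ} → Mat n → Set
EvenRestrictions k {n} M =
  (B : Vec (Vec Bool n) k) → LinIndep B → Even (restrSize M B)

-- Isomorphism: (E,G) ≅ (E',G') iff there is a bijective linear map
-- G' → G carrying E' onto E.  Over F₂, linear = additive.

Additive : {m n : ℕ} → (Vec Bool m → Vec Bool n) → Set
Additive f = ∀ x y → f (x ⊕ y) ≡ f x ⊕ f y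

Iso : {n m : ℕ} → Mat n → Mat m → Set
Iso {n} {m} M M' =
  Σ (Vec Bool m → Vec Bool n) λ f →
    Additive f × Bijective _≡_ _≡_ f × (∀ v → E M (f v) ≡ E M' v)

-- Twist doubling (a concrete representative; it is well defined only
-- up to isomorphism).  G' = F₂^(n+1), G = {false ∷ x} is a hyperplane,
-- w = true ∷ 0 ∉ G, and w + (false ∷ x) = true ∷ x.
-- E' = E ∪ {w + x : x ∈ E △ D}.

twistE : {n : ℕ} → Mat n → Mat n → Vec Bool (suc n) → Bool
twistE M N (false ∷ x) = E M x
twistE M N (true ∷ x) = E M x xor E N x

twistE-0 : {n : ℕ} (M N : Mat n) → twistE M N (𝟎 (suc n)) ≡ false
twistE-0 {n} M N = E-0 M

twist : {n : ℕ} → Mat n → Mat n → Mat (suc n)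
twist M N = record { E = twistE M N ; E-0 = twistE-0 M N }

data TwistBuilt (k : ℕ) : {m : ℕ} → Mat m → Set where
  base : {n : ℕ} (M₀ : Mat n) → n ≤ k ∸ 1 → TwistBuilt k M₀
  step : {n m : ℕ} {Mᵢ : Mat n} → TwistBuilt k Mᵢ →
         (Nᵢ : Mat n) → InClassE (k ∸ 1) Nᵢ →
         (Mᵢ₊₁ : Mat m) → Iso Mᵢ₊₁ (twist Mᵢ Nᵢ) → TwistBuilt k Mᵢ₊₁

-- Everything is counted modulo 2: the parity of |E ∩ F| for a flat F is the F₂-sum of
-- the indicator of E over a cube linearly embedded onto F ∪ {0}, so each class is
-- described by the vanishing of such sums along linear embeddings.
-- (2) ⇒ (1): a (d+2)-space is the sum of three of its hyperplanes through a common
-- d-space, so evenness propagates upward from dimension k.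
-- (3) ⇒ (1): after a transvection an embedding either lies in the hyperplane G, where
-- the twist doubling is M, or G splits its sum into an M-part over the span of a d-space
-- and a point, and an N-part over a coset of that d-space; both vanish.
-- (1) ⇒ (3): the whole space is an even flat, so some nonzero x lies outside E; a
-- transvection moving the point w = true ∷ 𝟎 of the twist doubling to x exhibits M as the
-- twist doubling of its restriction to a hyperplane (still in 𝓔_k) with respect to the
-- sum over the fibres of the projection from w (in 𝓔_{k-1}); recurse on the dimension.

module Submission where

open import Defs
open import Algebra.Bundles using (CommutativeRing; CommutativeSemigroup)
open import Algebra.Structures using (IsCommutativeMonoid)
open import Data.Bool using (Bool; true; false; _∧_; _xor_; not; if_then_else_)
open import Data.Bool.Properties
  using (xor-∧-commutativeRing; xor-assoc; xor-comm; xor-identityˡ; xor-identityʳ; xor-same;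
         ∧-identityʳ; ∧-zeroʳ; ∧-distribʳ-xor; not-involutive; not-distribˡ-xor; ⇔→≡; T-≡)
open import Data.Bool.ListAction using (any)
open import Data.Empty using (⊥-elim)
open import Data.List using (List; []; _∷_; _++_; map; filter; length)
open import Data.List.Membership.Propositional using (_∈_; lose)
open import Data.List.Membership.Propositional.Properties using (∈-map⁺; ∈-++⁺ˡ; ∈-++⁺ʳ)
open import Data.List.Properties using (filter-++; length-++)
open import Data.List.Relation.Unary.Any using (here)
open import Data.List.Relation.Unary.Any.Properties using (any⁺)
open import Data.Nat using (ℕ; zero; suc; _+_; _≤_; _≤′_; z≤n; s≤s; ≤′-refl; ≤′-step; _≤?_)
open import Data.Nat.Properties using (≤-refl; ≤-trans; m≤n⇒m≤1+n; ≤⇒≤′; ≰⇒>; <⇒≱)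
open import Data.Product using (Σ; ∃; _×_; _,_; proj₁; proj₂)
open import Data.Sum using (_⊎_; inj₁; inj₂)
open import Data.Vec using (Vec; []; _∷_; head; tail)
open import Data.Vec.Properties
  using (zipWith-assoc; zipWith-comm; zipWith-identityˡ; zipWith-identityʳ; ∷-injective)
open import Function using (_∘_; id)
open import Function.Bundles using (_⇔_; mk⇔; Equivalence)
open import Function.Consequences.Propositional using (strictlySurjective⇒surjective)
open import Function.Definitions using (Injective; Bijective)
open import Level using (0ℓ)
open import Relation.Binary.PropositionalEquality
open import Relation.Nullary using (yes; no)
open import Relation.Nullary.Decidable using (T?)

V : ℕ → Set
V = Vec Bool

module SelfInverse {A : Set} {_∙_ : A → A → A} {ε : A}
  (isCommutativeMonoid : IsCommutativeMonoid _≡_ _∙_ ε) (self : ∀ x → x ∙ x ≡ ε) where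

  open IsCommutativeMonoid isCommutativeMonoid public using (assoc; identityˡ; identityʳ)

  commutativeSemigroup : CommutativeSemigroup 0ℓ 0ℓ
  commutativeSemigroup = record
    { isCommutativeSemigroup = IsCommutativeMonoid.isCommutativeSemigroup isCommutativeMonoid }

  open import Algebra.Properties.CommutativeSemigroup commutativeSemigroup public
    using (interchange; x∙yz≈y∙xz)

  cancelˡ : ∀ x y → x ∙ (x ∙ y) ≡ y
  cancelˡ x y = begin
    x ∙ (x ∙ y)  ≡⟨ assoc x x y ⟨
    (x ∙ x) ∙ y  ≡⟨ cong (_∙ y) (self x) ⟩
    ε ∙ y        ≡⟨ identityˡ y ⟩
    y            ∎
    where open ≡-Reasoning

  cancel : ∀ x y z → (x ∙ y) ∙ (x ∙ z) ≡ y ∙ z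
  cancel x y z = trans (interchange x y x z) (trans (cong (_∙ (y ∙ z)) (self x)) (identityˡ (y ∙ z)))

  ∙≡ε⇒≡ : ∀ {x y} → x ∙ y ≡ ε → x ≡ y
  ∙≡ε⇒≡ {x} {y} e = sym (trans (sym (cancelˡ x y)) (trans (cong (x ∙_) e) (identityʳ x)))

module Xor = SelfInverse (CommutativeRing.+-isCommutativeMonoid xor-∧-commutativeRing) xor-same

⊕-isCommutativeMonoid : ∀ n → IsCommutativeMonoid _≡_ (_⊕_ {n}) (𝟎 n)
⊕-isCommutativeMonoid n = record
  { isMonoid = record
    { isSemigroup = record
      { isMagma = record { isEquivalence = isEquivalence ; ∙-cong = cong₂ _⊕_ }
      ; assoc = zipWith-assoc xor-assoc }
    ; identity = zipWith-identityˡ xor-identityˡ , zipWith-identityʳ xor-identityʳ }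
  ; comm = zipWith-comm xor-comm }

⊕-self : ∀ {n} (x : V n) → x ⊕ x ≡ 𝟎 n
⊕-self []      = refl
⊕-self (a ∷ x) = cong₂ _∷_ (xor-same a) (⊕-self x)

module ⊕ {n : ℕ} = SelfInverse (⊕-isCommutativeMonoid n) (⊕-self {n})

tail-⊕ : ∀ {n} (x y : V (suc n)) → tail (x ⊕ y) ≡ tail x ⊕ tail y
tail-⊕ (a ∷ x) (b ∷ y) = refl

==-sound : ∀ {n} (u v : V n) → u == v ≡ true → u ≡ v
==-sound []          []          _  = refl
==-sound (true ∷ u)  (true ∷ v)  e  = cong (true ∷_) (==-sound u v e)
==-sound (false ∷ u) (false ∷ v) e  = cong (false ∷_) (==-sound u v e)
==-sound (true ∷ u)  (false ∷ v) ()
==-sound (false ∷ u) (true ∷ v)  ()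

==-refl : ∀ {n} (u : V n) → u == u ≡ true
==-refl []          = refl
==-refl (true ∷ u)  = ==-refl u
==-refl (false ∷ u) = ==-refl u

==-complete : ∀ {n} {u v : V n} → u ≡ v → u == v ≡ true
==-complete {u = u} refl = ==-refl u

==-cong : ∀ {m n} {u v : V m} {x y : V n} → (u ≡ v ⇔ x ≡ y) → (u == v) ≡ (x == y)
==-cong {u = u} {v} {x} {y} u≡v⇔x≡y = ⇔→≡ {z = true} (mk⇔
  (λ p → ==-complete (Equivalence.to   u≡v⇔x≡y (==-sound u v p)))
  (λ p → ==-complete (Equivalence.from u≡v⇔x≡y (==-sound x y p))))

search : ∀ n (p : V n → Bool) → (∃ λ v → p v ≡ true) ⊎ (∀ v → p v ≡ false)
search zero p with p [] in e
... | true  = inj₁ ([] , e)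
... | false = inj₂ λ { [] → e }
search (suc n) p with search n (p ∘ (false ∷_)) | search n (p ∘ (true ∷_))
... | inj₁ (v , e) | _            = inj₁ (false ∷ v , e)
... | inj₂ _       | inj₁ (v , e) = inj₁ (true ∷ v , e)
... | inj₂ none₀   | inj₂ none₁   = inj₂ λ { (false ∷ v) → none₀ v ; (true ∷ v) → none₁ v }

parity : ∀ n → (V n → Bool) → Bool
parity zero    P = P []
parity (suc n) P = parity n (P ∘ (false ∷_)) xor parity n (P ∘ (true ∷_))

parity-cong : ∀ n {P Q : V n → Bool} → (∀ v → P v ≡ Q v) → parity n P ≡ parity n Q
parity-cong zero    e = e []
parity-cong (suc n) e = cong₂ _xor_ (parity-cong n (e ∘ (false ∷_))) (parity-cong n (e ∘ (true ∷_)))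

parity-false : ∀ n → parity n (λ _ → false) ≡ false
parity-false zero    = refl
parity-false (suc n) = cong₂ _xor_ (parity-false n) (parity-false n)

parity-xor : ∀ n (P Q : V n → Bool) → parity n (λ v → P v xor Q v) ≡ parity n P xor parity n Q
parity-xor zero    P Q = refl
parity-xor (suc n) P Q =
  trans (cong₂ _xor_ (parity-xor n (P ∘ (false ∷_)) (Q ∘ (false ∷_)))
                     (parity-xor n (P ∘ (true ∷_)) (Q ∘ (true ∷_))))
        (Xor.interchange (parity n (P ∘ (false ∷_))) (parity n (Q ∘ (false ∷_)))
                         (parity n (P ∘ (true ∷_))) (parity n (Q ∘ (true ∷_))))

parity-∧ʳ : ∀ n (P : V n → Bool) b → parity n (λ v → P v ∧ b) ≡ parity n P ∧ b
parity-∧ʳ zero    P b = refl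
parity-∧ʳ (suc n) P b =
  trans (cong₂ _xor_ (parity-∧ʳ n (P ∘ (false ∷_)) b) (parity-∧ʳ n (P ∘ (true ∷_)) b))
        (sym (∧-distribʳ-xor b (parity n (P ∘ (false ∷_))) (parity n (P ∘ (true ∷_)))))

parity-swap : ∀ m n (P : V m → V n → Bool) →
  parity m (λ x → parity n (P x)) ≡ parity n (λ y → parity m (λ x → P x y))
parity-swap zero    n P = refl
parity-swap (suc m) n P =
  trans (cong₂ _xor_ (parity-swap m n (P ∘ (false ∷_))) (parity-swap m n (P ∘ (true ∷_))))
        (sym (parity-xor n (λ y → parity m (λ x → P (false ∷ x) y))
                           (λ y → parity m (λ x → P (true ∷ x) y))))

parity-point : ∀ n (u : V n) → parity n (u ==_) ≡ true
parity-point zero    []          = refl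
parity-point (suc n) (true ∷ u)  = cong₂ _xor_ (parity-false n) (parity-point n u)
parity-point (suc n) (false ∷ u) = cong₂ _xor_ (parity-point n u) (parity-false n)

parity-witness : ∀ n (P : V n → Bool) → parity n P ≡ true → ∃ λ v → P v ≡ true
parity-witness zero    P e = [] , e
parity-witness (suc n) P e with parity n (P ∘ (false ∷_)) in e₀
... | true  = let v , Pv = parity-witness n _ e₀ in false ∷ v , Pv
... | false = let v , Pv = parity-witness n _ e in true ∷ v , Pv

parity-pushforward : ∀ {d n} (g : V d → V n) (P : V n → Bool) →
  parity n (λ v → parity d (λ c → g c == v) ∧ P v) ≡ parity d (P ∘ g)
parity-pushforward {d} {n} g P = begin
  parity n (λ v → parity d (λ c → g c == v) ∧ P v)
    ≡⟨ parity-cong n (λ v → parity-∧ʳ d (λ c → g c == v) (P v)) ⟨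
  parity n (λ v → parity d (λ c → (g c == v) ∧ P v))
    ≡⟨ parity-swap n d (λ v c → (g c == v) ∧ P v) ⟩
  parity d (λ c → parity n (λ v → (g c == v) ∧ P v))
    ≡⟨ parity-cong d (λ c → parity-cong n (==-∧ (g c))) ⟩
  parity d (λ c → parity n (λ v → (g c == v) ∧ P (g c)))
    ≡⟨ parity-cong d (λ c → parity-∧ʳ n (g c ==_) (P (g c))) ⟩
  parity d (λ c → parity n (g c ==_) ∧ P (g c))
    ≡⟨ parity-cong d (λ c → cong (_∧ P (g c)) (parity-point n (g c))) ⟩
  parity d (P ∘ g) ∎
  where
  open ≡-Reasoning
  ==-∧ : ∀ u v → (u == v) ∧ P v ≡ (u == v) ∧ P u
  ==-∧ u v with u == v in e
  ... | true  = cong P (sym (==-sound u v e))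
  ... | false = refl

parity-∘-bijection : ∀ n (f g : V n → V n) → (∀ x → g (f x) ≡ x) → (∀ y → f (g y) ≡ y) →
  (P : V n → Bool) → parity n (P ∘ f) ≡ parity n P
parity-∘-bijection n f g gf fg P = begin
  parity n (P ∘ f)                                  ≡⟨ parity-pushforward f P ⟨
  parity n (λ v → parity n (λ c → f c == v) ∧ P v)  ≡⟨ parity-cong n (cong (_∧ P _) ∘ fibre) ⟩
  parity n P                                        ∎
  where
  open ≡-Reasoning
  fibre : ∀ v → parity n (λ c → f c == v) ≡ true
  fibre v = trans
    (parity-cong n (λ c → ==-cong {u = f c} {v} {g v} {c} (mk⇔ (λ { refl → gf c }) (λ { refl → fg v }))))
    (parity-point n (g v))

odd : ℕ → Bool
odd zero    = false
odd (suc m) = not (odd m)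

odd-+ : ∀ m n → odd (m + n) ≡ odd m xor odd n
odd-+ zero    n = refl
odd-+ (suc m) n = trans (cong not (odd-+ m n)) (not-distribˡ-xor (odd m) (odd n))

even⇔¬odd : ∀ m → Even m ⇔ odd m ≡ false
even⇔¬odd zero                = mk⇔ (λ _ → refl) (λ _ → refl)
even⇔¬odd (suc zero)          = mk⇔ (λ ()) (λ ())
even⇔¬odd (suc (suc m)) rewrite not-involutive (odd m) = even⇔¬odd m

count-++ : ∀ {A : Set} (p : A → Bool) xs ys → count p (xs ++ ys) ≡ count p xs + count p ys
count-++ p xs ys =
  trans (cong length (filter-++ (λ x → T? (p x)) xs ys)) (length-++ (filter (λ x → T? (p x)) xs))

count-map : ∀ {A B : Set} (p : B → Bool) (f : A → B) xs → count p (map f xs) ≡ count (p ∘ f) xs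
count-map p f []       = refl
count-map p f (x ∷ xs) with p (f x)
... | true  = cong suc (count-map p f xs)
... | false = count-map p f xs

odd-count-allVecs : ∀ n (P : V n → Bool) → odd (count P (allVecs n)) ≡ parity n P
odd-count-allVecs zero    P with P []
... | true  = refl
... | false = refl
odd-count-allVecs (suc n) P = begin
  odd (count P (half false ++ half true))
    ≡⟨ cong odd (count-++ P (half false) (half true)) ⟩
  odd (count P (half false) + count P (half true))
    ≡⟨ odd-+ (count P (half false)) (count P (half true)) ⟩
  odd (count P (half false)) xor odd (count P (half true))
    ≡⟨ cong₂ _xor_ (odd-half false) (odd-half true) ⟩
  parity (suc n) P ∎
  where
  open ≡-Reasoning
  half : Bool → List (V (suc n))
  half b = map (b ∷_) (allVecs n)
  odd-half : ∀ b → odd (count P (half b)) ≡ parity n (P ∘ (b ∷_))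
  odd-half b = trans (cong odd (count-map P (b ∷_) (allVecs n))) (odd-count-allVecs n (P ∘ (b ∷_)))

∈-allVecs : ∀ {n} (v : V n) → v ∈ allVecs n
∈-allVecs []          = here refl
∈-allVecs (false ∷ v) = ∈-++⁺ˡ (∈-map⁺ (false ∷_) (∈-allVecs v))
∈-allVecs (true ∷ v)  = ∈-++⁺ʳ (map (false ∷_) (allVecs _)) (∈-map⁺ (true ∷_) (∈-allVecs v))

any-allVecs-true : ∀ {n} (p : V n → Bool) v → p v ≡ true → any p (allVecs n) ≡ true
any-allVecs-true p v pv = Equivalence.to T-≡ (any⁺ p (lose (∈-allVecs v) (Equivalence.from T-≡ pv)))

any-false : ∀ {A : Set} (p : A → Bool) xs → (∀ x → p x ≡ false) → any p xs ≡ false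
any-false p []       none = refl
any-false p (x ∷ xs) none rewrite none x = any-false p xs none

any-allVecs≡parity : ∀ {d n} (g : V d → V n) → Injective _≡_ _≡_ g →
  ∀ v → any (λ c → g c == v) (allVecs d) ≡ parity d (λ c → g c == v)
any-allVecs≡parity {d} g inj v with search d (λ c → g c == v)
... | inj₁ (c₀ , gc₀==v) =
  trans (any-allVecs-true _ c₀ gc₀==v)
        (sym (trans (parity-cong d (λ c → ==-cong {u = g c} {v} {c₀} {c} (mk⇔
                      (λ gc≡v → inj (trans (==-sound _ _ gc₀==v) (sym gc≡v)))
                      (λ { refl → ==-sound _ _ gc₀==v }))))
                    (parity-point d c₀)))
... | inj₂ none = trans (any-false _ (allVecs d) none) (sym (trans (parity-cong d none) (parity-false d)))

odd-restrSize : ∀ {n d} (M : Mat n) (B : Vec (V n) d) → Injective _≡_ _≡_ (comb B) →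
  odd (restrSize M B) ≡ parity d (E M ∘ comb B)
odd-restrSize {n} {d} M B inj = begin
  odd (restrSize M B)
    ≡⟨ odd-count-allVecs n (λ v → not (isZero v) ∧ (inSpan B v ∧ E M v)) ⟩
  parity n (λ v → not (isZero v) ∧ (inSpan B v ∧ E M v))
    ≡⟨ parity-cong n restrict ⟩
  parity n (λ v → parity d (λ c → comb B c == v) ∧ E M v)
    ≡⟨ parity-pushforward (comb B) (E M) ⟩
  parity d (E M ∘ comb B) ∎
  where
  open ≡-Reasoning
  restrict : ∀ v → not (isZero v) ∧ (inSpan B v ∧ E M v) ≡ parity d (λ c → comb B c == v) ∧ E M v
  restrict v with isZero v in z
  ... | true rewrite ==-sound v (𝟎 n) z | E-0 M = sym (∧-zeroʳ _)
  ... | false = cong (_∧ E M v) (any-allVecs≡parity (comb B) inj v)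

additive-𝟎 : ∀ {m n} {f : V m → V n} → Additive f → f (𝟎 m) ≡ 𝟎 n
additive-𝟎 {m} {f = f} f-add = trans (cong f (sym (⊕-self (𝟎 m)))) (trans (f-add _ _) (⊕-self _))

trivialKernel⇒injective : ∀ {m n} {f : V m → V n} → Additive f →
  (∀ c → f c ≡ 𝟎 n → c ≡ 𝟎 m) → Injective _≡_ _≡_ f
trivialKernel⇒injective {f = f} f-add ker {x} {y} fx≡fy =
  ⊕.∙≡ε⇒≡ (ker (x ⊕ y) (trans (f-add x y) (trans (cong (_⊕ f y) fx≡fy) (⊕-self (f y)))))

injective⇒trivialKernel : ∀ {m n} {f : V m → V n} → Additive f → Injective _≡_ _≡_ f →
  ∀ c → f c ≡ 𝟎 n → c ≡ 𝟎 m
injective⇒trivialKernel f-add inj c fc≡𝟎 = inj (trans fc≡𝟎 (sym (additive-𝟎 f-add)))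

record LinearEmbedding (d n : ℕ) : Set where
  field
    to        : V d → V n
    additive  : Additive to
    injective : Injective _≡_ _≡_ to
open LinearEmbedding public

_∘ₗ_ : ∀ {d m n} → LinearEmbedding m n → LinearEmbedding d m → LinearEmbedding d n
g ∘ₗ f = record
  { to        = to g ∘ to f
  ; additive  = λ x y → trans (cong (to g) (additive f x y)) (additive g _ _)
  ; injective = λ e → injective f (injective g e) }

idₗ : ∀ {n} → LinearEmbedding n n
idₗ = record { to = id ; additive = λ _ _ → refl ; injective = id }

false∷ₗ : ∀ {n} → LinearEmbedding n (suc n)
false∷ₗ = record
  { to = false ∷_ ; additive = λ _ _ → refl ; injective = λ e → proj₂ (∷-injective e) }

lift : ∀ {d n} → (V d → V n) → V (suc d) → V (suc n)
lift f (x ∷ c) = x ∷ f c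

liftₗ : ∀ {d n} → LinearEmbedding d n → LinearEmbedding (suc d) (suc n)
liftₗ L = record { to = lift (to L) ; additive = lift-additive ; injective = lift-injective }
  where
  lift-additive : Additive (lift (to L))
  lift-additive (x ∷ c) (y ∷ c′) = cong ((x xor y) ∷_) (additive L c c′)
  lift-injective : Injective _≡_ _≡_ (lift (to L))
  lift-injective {x ∷ c} {y ∷ c′} e with ∷-injective e
  ... | x≡y , Lc≡Lc′ = cong₂ _∷_ x≡y (injective L Lc≡Lc′)

diagonal : ∀ {d} → V (suc d) → V (suc (suc d))
diagonal (x ∷ c) = x ∷ x ∷ c

diagonalₗ : ∀ {d} → LinearEmbedding (suc d) (suc (suc d))
diagonalₗ = record { to = diagonal ; additive = diagonal-additive ; injective = diagonal-injective }
  where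
  diagonal-additive : Additive diagonal
  diagonal-additive (x ∷ c) (y ∷ c′) = refl
  diagonal-injective : Injective _≡_ _≡_ diagonal
  diagonal-injective {x ∷ c} {y ∷ c′} e = proj₂ (∷-injective e)

comb-additive : ∀ {n d} (B : Vec (V n) d) → Additive (comb B)
comb-additive []      []          []          = sym (⊕-self _)
comb-additive (b ∷ B) (false ∷ x) (false ∷ y) = comb-additive B x y
comb-additive (b ∷ B) (true ∷ x)  (false ∷ y) =
  trans (cong (b ⊕_) (comb-additive B x y)) (sym (⊕.assoc b _ _))
comb-additive (b ∷ B) (false ∷ x) (true ∷ y)  =
  trans (cong (b ⊕_) (comb-additive B x y)) (⊕.x∙yz≈y∙xz b _ _)
comb-additive (b ∷ B) (true ∷ x)  (true ∷ y)  =
  trans (comb-additive B x y) (sym (⊕.cancel b _ _))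

span : ∀ {n d} (B : Vec (V n) d) → LinIndep B → LinearEmbedding d n
span B independent = record
  { to        = comb B
  ; additive  = comb-additive B
  ; injective = trivialKernel⇒injective (comb-additive B) independent }

basis : ∀ {d n} → (V d → V n) → Vec (V n) d
basis {zero}  f = []
basis {suc d} f = f (true ∷ 𝟎 d) ∷ basis (f ∘ (false ∷_))

additive-false∷ : ∀ {d n} {f : V (suc d) → V n} → Additive f → Additive (f ∘ (false ∷_))
additive-false∷ f-add x y = f-add (false ∷ x) (false ∷ y)

comb-basis : ∀ {d n} (f : V d → V n) → Additive f → ∀ c → comb (basis f) c ≡ f c
comb-basis {zero}  f f-add []          = sym (additive-𝟎 f-add)
comb-basis {suc d} f f-add (false ∷ c) = comb-basis (f ∘ (false ∷_)) (additive-false∷ f-add) c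
comb-basis {suc d} f f-add (true ∷ c)  = begin
  f (true ∷ 𝟎 d) ⊕ comb (basis (f ∘ (false ∷_))) c
    ≡⟨ cong (f (true ∷ 𝟎 d) ⊕_) (comb-basis (f ∘ (false ∷_)) (additive-false∷ f-add) c) ⟩
  f (true ∷ 𝟎 d) ⊕ f (false ∷ c)  ≡⟨ f-add (true ∷ 𝟎 d) (false ∷ c) ⟨
  f (true ∷ (𝟎 d ⊕ c))            ≡⟨ cong (λ x → f (true ∷ x)) (⊕.identityˡ c) ⟩
  f (true ∷ c)                    ∎
  where open ≡-Reasoning

basis-linIndep : ∀ {d n} (L : LinearEmbedding d n) → LinIndep (basis (to L))
basis-linIndep L c e =
  injective⇒trivialKernel (additive L) (injective L) c (trans (sym (comb-basis (to L) (additive L) c)) e)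

-- Subspaces contain 0, which lies in no matroid, so for P = E M this is the
-- evenness of all d-dimensional induced restrictions.
EvenOnDim : ∀ {n} → ℕ → (V n → Bool) → Set
EvenOnDim {n} d P = (L : LinearEmbedding d n) → parity d (P ∘ to L) ≡ false

EvenAbove : ∀ {n} → ℕ → (V n → Bool) → Set
EvenAbove k P = ∀ d → k ≤ d → EvenOnDim d P

even-restrSize⇔parity : ∀ {n d} (M : Mat n) (B : Vec (V n) d) → LinIndep B →
  Even (restrSize M B) ⇔ parity d (E M ∘ comb B) ≡ false
even-restrSize⇔parity M B independent =
  subst (λ b → Even (restrSize M B) ⇔ b ≡ false)
        (odd-restrSize M B (injective (span B independent)))
        (even⇔¬odd (restrSize M B))

evenRestrictions⇔evenOnDim : ∀ d {n} (M : Mat n) → EvenRestrictions d M ⇔ EvenOnDim d (E M)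
evenRestrictions⇔evenOnDim d M = mk⇔
  (λ even L → trans (parity-cong d (λ c → cong (E M) (sym (comb-basis (to L) (additive L) c))))
                    (Equivalence.to (even-restrSize⇔parity M (basis (to L)) (basis-linIndep L))
                                    (even (basis (to L)) (basis-linIndep L))))
  (λ even B independent → Equivalence.from (even-restrSize⇔parity M B independent) (even (span B independent)))

inClassE⇔evenAbove : ∀ k {n} (M : Mat n) → InClassE k M ⇔ EvenAbove k (E M)
inClassE⇔evenAbove k M = mk⇔
  (λ inE d k≤d → Equivalence.to   (evenRestrictions⇔evenOnDim d M) (inE d k≤d))
  (λ even d k≤d → Equivalence.from (evenRestrictions⇔evenOnDim d M) (even d k≤d))

-- A (d+2)-space is covered by its three hyperplanes through a fixed d-subspace W:
-- each coset of W other than W lies in exactly one of them, and W in all three.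
evenOnDim-suc : ∀ {n d} {P : V n → Bool} → EvenOnDim (suc d) P → EvenOnDim (suc (suc d)) P
evenOnDim-suc {d = d} {P} even L = begin
  (a xor b) xor (c xor e)
    ≡⟨ cong ((a xor b) xor_) (Xor.cancel a c e) ⟨
  (a xor b) xor ((a xor c) xor (a xor e))
    ≡⟨ cong₂ _xor_ (even (L ∘ₗ false∷ₗ)) (cong₂ _xor_ (even (L ∘ₗ liftₗ false∷ₗ)) (even (L ∘ₗ diagonalₗ))) ⟩
  false ∎
  where
  open ≡-Reasoning
  coset : Bool → Bool → Bool
  coset x y = parity d (λ v → P (to L (x ∷ y ∷ v)))
  a = coset false false
  b = coset false true
  c = coset true false
  e = coset true true

evenOnDim⇒evenAbove : ∀ {n k} {P : V n → Bool} → EvenOnDim (suc k) P → EvenAbove (suc k) P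
evenOnDim⇒evenAbove {k = k} {P} even (suc d) (s≤s k≤d) = go (≤⇒≤′ k≤d)
  where
  go : ∀ {d} → k ≤′ d → EvenOnDim (suc d) P
  go ≤′-refl       = even
  go (≤′-step k≤d) = evenOnDim-suc {P = P} (go k≤d)

evenAbove-∘ : ∀ {m n k} {P : V n → Bool} (g : LinearEmbedding m n) →
  EvenAbove k P → EvenAbove k (P ∘ to g)
evenAbove-∘ g even d k≤d L = even d k≤d (g ∘ₗ L)

evenAbove-cong : ∀ {n k} {P Q : V n → Bool} → (∀ v → P v ≡ Q v) → EvenAbove k P → EvenAbove k Q
evenAbove-cong P≗Q even d k≤d L = trans (parity-cong d (sym ∘ P≗Q ∘ to L)) (even d k≤d L)

involution⇒bijective : ∀ {n} {f : V n → V n} → (∀ x → f (f x) ≡ x) → Bijective _≡_ _≡_ f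
involution⇒bijective {f = f} inv =
  (λ {x} {y} fx≡fy → trans (sym (inv x)) (trans (cong f fx≡fy) (inv y))) ,
  strictlySurjective⇒surjective (λ y → f y , inv y)

record IsLinearForm {n} (φ : V n → Bool) : Set where
  constructor linearForm
  field
    ⊕-homo : ∀ x y → φ (x ⊕ y) ≡ φ x xor φ y
open IsLinearForm public

linearForm-𝟎 : ∀ {n} {φ : V n → Bool} → IsLinearForm φ → φ (𝟎 n) ≡ false
linearForm-𝟎 {n} {φ} φ-lin =
  trans (cong φ (sym (⊕-self (𝟎 n)))) (trans (⊕-homo φ-lin _ _) (xor-same (φ (𝟎 n))))

head-linear : ∀ {n} → IsLinearForm (head {n = n})
head-linear = linearForm λ { (a ∷ x) (b ∷ y) → refl }

linearForm-∘ : ∀ {m n} {φ : V n → Bool} {f : V m → V n} →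
  IsLinearForm φ → Additive f → IsLinearForm (φ ∘ f)
linearForm-∘ {φ = φ} φ-lin f-add = linearForm λ x y → trans (cong φ (f-add x y)) (⊕-homo φ-lin _ _)

xor-linear : ∀ {n} {φ ψ : V n → Bool} →
  IsLinearForm φ → IsLinearForm ψ → IsLinearForm (λ x → φ x xor ψ x)
xor-linear {φ = φ} {ψ} φ-lin ψ-lin = linearForm λ x y →
  trans (cong₂ _xor_ (⊕-homo φ-lin x y) (⊕-homo ψ-lin x y)) (Xor.interchange (φ x) (φ y) (ψ x) (ψ y))

∃-common-true : ∀ {n} {φ ψ : V n → Bool} → IsLinearForm φ → IsLinearForm ψ →
  ∀ {a b} → φ a ≡ true → ψ b ≡ true → ∃ λ α → φ α ≡ true × ψ α ≡ true
∃-common-true {φ = φ} {ψ} φ-lin ψ-lin {a} {b} φa ψb with φ b in φb | ψ a in ψa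
... | true  | _     = b , φb , ψb
... | false | true  = a , φa , ψa
... | false | false =
  a ⊕ b , trans (⊕-homo φ-lin a b) (cong₂ _xor_ φa φb) , trans (⊕-homo ψ-lin a b) (cong₂ _xor_ ψa ψb)

scale : ∀ {n} → Bool → V n → V n
scale b α = if b then α else 𝟎 _

scale-xor : ∀ {n} a b (α : V n) → scale (a xor b) α ≡ scale a α ⊕ scale b α
scale-xor true  true  α = sym (⊕-self α)
scale-xor true  false α = sym (⊕.identityʳ α)
scale-xor false true  α = sym (⊕.identityˡ α)
scale-xor false false α = sym (⊕.identityˡ (𝟎 _))

linearForm-scale : ∀ {n} {ψ : V n → Bool} → IsLinearForm ψ → ∀ b α → ψ (scale b α) ≡ b ∧ ψ α
linearForm-scale ψ-lin true  α = refl
linearForm-scale ψ-lin false α = linearForm-𝟎 ψ-lin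

transvection : ∀ {n} → (V n → Bool) → V n → V n → V n
transvection φ α x = x ⊕ scale (φ x) α

module _ {n} {φ : V n → Bool} (φ-lin : IsLinearForm φ) (α : V n) where

  transvection-additive : Additive (transvection φ α)
  transvection-additive x y =
    trans (cong (λ b → (x ⊕ y) ⊕ scale b α) (⊕-homo φ-lin x y))
          (trans (cong ((x ⊕ y) ⊕_) (scale-xor (φ x) (φ y) α)) (⊕.interchange x y _ _))

  transvection-linearForm : ∀ {ψ : V n → Bool} → IsLinearForm ψ →
    ∀ x → ψ (transvection φ α x) ≡ ψ x xor (φ x ∧ ψ α)
  transvection-linearForm {ψ} ψ-lin x =
    trans (⊕-homo ψ-lin x _) (cong (ψ x xor_) (linearForm-scale ψ-lin (φ x) α))

  module _ (φα : φ α ≡ false) where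

    transvection-involutive : ∀ x → transvection φ α (transvection φ α x) ≡ x
    transvection-involutive x = begin
      transvection φ α x ⊕ scale (φ (transvection φ α x)) α
        ≡⟨ cong (λ b → transvection φ α x ⊕ scale b α) φTx≡φx ⟩
      (x ⊕ scale (φ x) α) ⊕ scale (φ x) α  ≡⟨ ⊕.assoc x _ _ ⟩
      x ⊕ (scale (φ x) α ⊕ scale (φ x) α)  ≡⟨ cong (x ⊕_) (⊕-self _) ⟩
      x ⊕ 𝟎 n                              ≡⟨ ⊕.identityʳ x ⟩
      x                                    ∎
      where
      open ≡-Reasoning
      φTx≡φx : φ (transvection φ α x) ≡ φ x
      φTx≡φx = trans (transvection-linearForm φ-lin x)
                     (trans (cong (λ b → φ x xor (φ x ∧ b)) φα)
                            (trans (cong (φ x xor_) (∧-zeroʳ (φ x))) (xor-identityʳ (φ x))))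

    transvectionₗ : LinearEmbedding n n
    transvectionₗ = record
      { to        = transvection φ α
      ; additive  = transvection-additive
      ; injective = proj₁ (involution⇒bijective transvection-involutive) }

data Transversality {d n} (L : LinearEmbedding (suc d) (suc n)) : Set where
  inHyperplane : (∀ c → head (to L c) ≡ false) → Transversality L
  transversal  : (K : LinearEmbedding (suc d) (suc n)) → (∀ c → head (to K c) ≡ head c) →
                 (∀ P → parity (suc d) (P ∘ to K) ≡ parity (suc d) (P ∘ to L)) → Transversality L

transvection-retarget : ∀ {n} {h h′ : V n → Bool} → IsLinearForm h → IsLinearForm h′ →
  ∀ {α} → h α ≡ true → h′ α ≡ true →
  ∀ c → h (transvection (λ x → h x xor h′ x) α c) ≡ h′ c
transvection-retarget {h = h} {h′} h-lin h′-lin {α} hα h′α c = begin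
  h (transvection (λ x → h x xor h′ x) α c)
    ≡⟨ transvection-linearForm (xor-linear h-lin h′-lin) α h-lin c ⟩
  h c xor ((h c xor h′ c) ∧ h α)              ≡⟨ cong (λ b → h c xor ((h c xor h′ c) ∧ b)) hα ⟩
  h c xor ((h c xor h′ c) ∧ true)             ≡⟨ cong (h c xor_) (∧-identityʳ _) ⟩
  h c xor (h c xor h′ c)                      ≡⟨ Xor.cancelˡ (h c) (h′ c) ⟩
  h′ c                                        ∎
  where open ≡-Reasoning

straighten : ∀ {d n} (L : LinearEmbedding (suc d) (suc n)) {α} →
  head (to L α) ≡ true → head α ≡ true → Transversality L
straighten {d} L {α} hα headα = transversal (L ∘ₗ T) (transvection-retarget h-lin head-linear hα headα)
  (λ P → parity-∘-bijection (suc d) (to T) (to T) T-inv T-inv (P ∘ to L))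
  where
  h-lin = linearForm-∘ head-linear (additive L)
  φ-lin = xor-linear h-lin head-linear
  T = transvectionₗ φ-lin α (cong₂ _xor_ hα headα)
  T-inv = transvection-involutive φ-lin α (cong₂ _xor_ hα headα)

transversality : ∀ {d n} (L : LinearEmbedding (suc d) (suc n)) → Transversality L
transversality {d} L with search (suc d) (head ∘ to L)
... | inj₂ inside = inHyperplane inside
... | inj₁ (_ , hc)
  with ∃-common-true (linearForm-∘ head-linear (additive L)) head-linear {b = true ∷ 𝟎 d} hc refl
...   | _ , hα , headα = straighten L hα headα

V₀-unique : (x y : V zero) → x ≡ y
V₀-unique [] [] = refl

≡-∷ : ∀ {n} {u v : V (suc n)} → head u ≡ head v → tail u ≡ tail v → u ≡ v
≡-∷ {u = _ ∷ _} {_ ∷ _} refl refl = refl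

tail-additive : ∀ {m n} {f : V m → V (suc n)} → Additive f → Additive (tail ∘ f)
tail-additive {f = f} f-add x y = trans (cong tail (f-add x y)) (tail-⊕ (f x) (f y))

tailₗ : ∀ {d n} (L : LinearEmbedding d (suc n)) → (∀ c → head (to L c) ≡ false) → LinearEmbedding d n
tailₗ L inside = record
  { to        = tail ∘ to L
  ; additive  = tail-additive (additive L)
  ; injective = λ {x} {y} e → injective L (≡-∷ (trans (inside x) (sym (inside y))) e) }

embedding-dim≤ : ∀ {d n} → LinearEmbedding d n → d ≤ n
embedding-dim≤ {zero}          L = z≤n
embedding-dim≤ {suc d} {zero}  L with injective L {true ∷ 𝟎 d} {𝟎 (suc d)} (V₀-unique _ _)
... | ()
embedding-dim≤ {suc d} {suc n} L with transversality L
... | inHyperplane inside   = m≤n⇒m≤1+n (embedding-dim≤ (tailₗ L inside))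
... | transversal K headK _ = s≤s (embedding-dim≤ (tailₗ (K ∘ₗ false∷ₗ) (headK ∘ (false ∷_))))

evenAbove-vacuous : ∀ {n k} {P : V n → Bool} → n ≤ k → EvenAbove (suc k) P
evenAbove-vacuous n≤k d k<d L = ⊥-elim (<⇒≱ k<d (≤-trans (embedding-dim≤ L) n≤k))

_▹_ : ∀ {d n} → (V d → V n) → V n → V (suc d) → V n
(f ▹ a) (false ∷ c) = f c
(f ▹ a) (true ∷ c)  = a ⊕ f c

▹-additive : ∀ {d n} {f : V d → V n} → Additive f → ∀ a → Additive (f ▹ a)
▹-additive f-add a (false ∷ x) (false ∷ y) = f-add x y
▹-additive f-add a (true ∷ x)  (false ∷ y) = trans (cong (a ⊕_) (f-add x y)) (sym (⊕.assoc a _ _))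
▹-additive f-add a (false ∷ x) (true ∷ y)  = trans (cong (a ⊕_) (f-add x y)) (⊕.x∙yz≈y∙xz a _ _)
▹-additive f-add a (true ∷ x)  (true ∷ y)  = trans (f-add x y) (sym (⊕.cancel a _ _))

additive-▹ : ∀ {d n} {f : V (suc d) → V n} → Additive f →
  ∀ c → f c ≡ ((f ∘ (false ∷_)) ▹ f (true ∷ 𝟎 d)) c
additive-▹     f-add (false ∷ c) = refl
additive-▹ {d} {f = f} f-add (true ∷ c) =
  trans (cong (λ x → f (true ∷ x)) (sym (⊕.identityˡ c))) (f-add (true ∷ 𝟎 d) (false ∷ c))

extendₗ : ∀ {d n} (K : LinearEmbedding d n) (a : V n) → (∀ c → to K c == a ≡ false) →
  LinearEmbedding (suc d) n
extendₗ {d} {n} K a a∉K = record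
  { to        = to K ▹ a
  ; additive  = ▹-additive (additive K) a
  ; injective = trivialKernel⇒injective (▹-additive (additive K) a) kernel }
  where
  kernel : ∀ c → (to K ▹ a) c ≡ 𝟎 n → c ≡ 𝟎 (suc d)
  kernel (false ∷ c) Kc≡𝟎  =
    cong (false ∷_) (injective⇒trivialKernel (additive K) (injective K) c Kc≡𝟎)
  kernel (true ∷ c) a⊕Kc≡𝟎 with trans (sym (==-complete (sym (⊕.∙≡ε⇒≡ a⊕Kc≡𝟎)))) (a∉K c)
  ... | ()

-- If a lies in the image of K the two halves are translates of each other;
-- otherwise K ▹ a is itself an embedding.
parity-▹ : ∀ {d n} {P : V n → Bool} → EvenOnDim (suc d) P →
  (K : LinearEmbedding d n) (a : V n) → parity (suc d) (P ∘ (to K ▹ a)) ≡ false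
parity-▹ {d} {P = P} even K a with search d (λ c → to K c == a)
... | inj₂ a∉K           = even (extendₗ K a a∉K)
... | inj₁ (c₀ , Kc₀==a) =
  trans (cong (parity d (P ∘ to K) xor_) translate) (xor-same (parity d (P ∘ to K)))
  where
  a+K≡K[c₀+_] : ∀ c → a ⊕ to K c ≡ to K (c₀ ⊕ c)
  a+K≡K[c₀+_] c = trans (cong (_⊕ to K c) (sym (==-sound _ _ Kc₀==a))) (sym (additive K c₀ c))
  translate : parity d (λ c → P (a ⊕ to K c)) ≡ parity d (P ∘ to K)
  translate = trans (parity-cong d (cong P ∘ a+K≡K[c₀+_]))
                    (parity-∘-bijection d (c₀ ⊕_) (c₀ ⊕_) (⊕.cancelˡ c₀) (⊕.cancelˡ c₀) (P ∘ to K))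

parity-coset : ∀ {d n} {P : V n → Bool} → EvenOnDim d P → EvenOnDim (suc d) P →
  (K : LinearEmbedding d n) (a : V n) → parity d (λ c → P (a ⊕ to K c)) ≡ false
parity-coset {d} {P = P} evenD evenSD K a =
  trans (sym (Xor.cancelˡ (parity d (P ∘ to K)) _)) (cong₂ _xor_ (evenD K) (parity-▹ {P = P} evenSD K a))

twistE-inHyperplane : ∀ {n} (M N : Mat n) v → head v ≡ false → twistE M N v ≡ E M (tail v)
twistE-inHyperplane M N (false ∷ x) refl = refl

parity-twist : ∀ {d n} (M N : Mat n) (f : V (suc d) → V n) →
  parity (suc d) (λ c → twistE M N (head c ∷ f c))
    ≡ parity (suc d) (E M ∘ f) xor parity d (λ c → E N (f (true ∷ c)))
parity-twist {d} M N f =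
  trans (cong (A xor_) (parity-xor d (λ c → E M (f (true ∷ c))) (λ c → E N (f (true ∷ c)))))
        (sym (xor-assoc A _ _))
  where A = parity d (λ c → E M (f (false ∷ c)))

twist-evenAbove : ∀ {n k} (M N : Mat n) → EvenAbove (suc k) (E M) → EvenAbove k (E N) →
  EvenAbove (suc k) (twistE M N)
twist-evenAbove M N evenM evenN (suc d) (s≤s k≤d) L with transversality L
... | inHyperplane inside =
  trans (parity-cong (suc d) (λ c → twistE-inHyperplane M N (to L c) (inside c)))
        (evenM (suc d) (s≤s k≤d) (tailₗ L inside))
... | transversal K headK parityK = begin
  parity (suc d) (twistE M N ∘ to L)
    ≡⟨ parityK (twistE M N) ⟨
  parity (suc d) (twistE M N ∘ to K)
    ≡⟨ parity-cong (suc d) (λ c → cong (twistE M N) (≡-∷ {u = to K c} {head c ∷ _} (headK c) refl)) ⟩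
  parity (suc d) (λ c → twistE M N (head c ∷ tail (to K c)))
    ≡⟨ parity-twist M N (tail ∘ to K) ⟩
  parity (suc d) (E M ∘ tail ∘ to K) xor parity d (λ c → E N (tail (to K (true ∷ c))))
    ≡⟨ cong₂ _xor_ evenPartM evenPartN ⟩
  false ∎
  where
  open ≡-Reasoning
  K₀ = tailₗ (K ∘ₗ false∷ₗ) (headK ∘ (false ∷_))
  a₀ = tail (to K (true ∷ 𝟎 d))
  tailK≡K₀▹a₀ : ∀ c → tail (to K c) ≡ (to K₀ ▹ a₀) c
  tailK≡K₀▹a₀ = additive-▹ (tail-additive (additive K))
  evenPartM : parity (suc d) (E M ∘ tail ∘ to K) ≡ false
  evenPartM = trans (parity-cong (suc d) (cong (E M) ∘ tailK≡K₀▹a₀))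
                    (parity-▹ {P = E M} (evenM (suc d) (s≤s k≤d)) K₀ a₀)
  evenPartN : parity d (λ c → E N (tail (to K (true ∷ c)))) ≡ false
  evenPartN = trans (parity-cong d (λ c → cong (E N) (tailK≡K₀▹a₀ (true ∷ c))))
                    (parity-coset {P = E N} (evenN d k≤d) (evenN (suc d) (m≤n⇒m≤1+n k≤d)) K₀ a₀)

inverseₗ : ∀ {m n} {f : V m → V n} → Additive f → Bijective _≡_ _≡_ f →
  Σ (LinearEmbedding n m) λ g → ∀ y → f (to g y) ≡ y
inverseₗ {f = f} f-add (f-inj , f-surj) = g , f∘g
  where
  f∘g : ∀ y → f (proj₁ (f-surj y)) ≡ y
  f∘g y = proj₂ (f-surj y) refl
  g = record
    { to        = proj₁ ∘ f-surj
    ; additive  = λ x y →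
        f-inj (trans (f∘g (x ⊕ y)) (sym (trans (f-add _ _) (cong₂ _⊕_ (f∘g x) (f∘g y)))))
    ; injective = λ {x} {y} e → trans (sym (f∘g x)) (trans (cong f e) (f∘g y)) }

evenAbove-iso : ∀ {m n k} {M : Mat m} {M′ : Mat n} → Iso M M′ → EvenAbove k (E M′) → EvenAbove k (E M)
evenAbove-iso {M = M} {M′} (f , f-add , f-bij , E∘f) even with inverseₗ f-add f-bij
... | g , f∘g = evenAbove-cong {P = E M′ ∘ to g} (λ v → trans (sym (E∘f (to g v))) (cong (E M) (f∘g v)))
                               (evenAbove-∘ {P = E M′} g even)

twistBuilt⇒evenAbove : ∀ {k m} {M : Mat m} → TwistBuilt (suc k) M → EvenAbove (suc k) (E M)
twistBuilt⇒evenAbove (base M₀ n≤k) = evenAbove-vacuous {P = E M₀} n≤k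
twistBuilt⇒evenAbove {k} (step {Mᵢ = Mᵢ} built N N∈E M iso) =
  evenAbove-iso {M = M} {twist Mᵢ N} iso
    (twist-evenAbove Mᵢ N (twistBuilt⇒evenAbove built) (Equivalence.to (inClassE⇔evenAbove k N) N∈E))

pullback : ∀ {m n} → Mat n → LinearEmbedding m n → Mat m
pullback M L = record { E = E M ∘ to L ; E-0 = trans (cong (E M) (additive-𝟎 (additive L))) (E-0 M) }

fibreSum : ∀ {n} → (V (suc n) → Bool) → V n → Bool
fibreSum P x = P (false ∷ x) xor P (true ∷ x)

fibre : ∀ {n} (M : Mat (suc n)) → E M (true ∷ 𝟎 n) ≡ false → Mat n
fibre M Eu≡false = record { E = fibreSum (E M) ; E-0 = cong₂ _xor_ (E-0 M) Eu≡false }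

twist-pullback-fibre : ∀ {n} (M : Mat (suc n)) (Eu≡false : E M (true ∷ 𝟎 n) ≡ false) →
  ∀ v → E M v ≡ twistE (pullback M false∷ₗ) (fibre M Eu≡false) v
twist-pullback-fibre M _ (false ∷ x) = refl
twist-pullback-fibre M _ (true ∷ x)  = sym (Xor.cancelˡ (E M (false ∷ x)) (E M (true ∷ x)))

evenAbove-fibreSum : ∀ {n k} {P : V (suc n) → Bool} → EvenAbove (suc k) P → EvenAbove k (fibreSum P)
evenAbove-fibreSum {P = P} even d k≤d L =
  trans (parity-xor d (λ c → P (false ∷ to L c)) (λ c → P (true ∷ to L c)))
        (even (suc d) (s≤s k≤d) (liftₗ L))

selector : ∀ {n} → V n → V n → Bool
selector []          []       = false
selector (true ∷ w)  (x ∷ _)  = x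
selector (false ∷ w) (_ ∷ xs) = selector w xs

selector-linear : ∀ {n} (w : V n) → IsLinearForm (selector w)
selector-linear w = linearForm (homo w)
  where
  homo : ∀ {n} (w : V n) x y → selector w (x ⊕ y) ≡ selector w x xor selector w y
  homo []          []       []       = refl
  homo (true ∷ w)  (x ∷ _)  (y ∷ _)  = refl
  homo (false ∷ w) (_ ∷ xs) (_ ∷ ys) = homo w xs ys

selector-self : ∀ {n} (w : V n) → isZero w ≡ false → selector w w ≡ true
selector-self (true ∷ w)  _   = refl
selector-self (false ∷ w) w≢𝟎 = selector-self w w≢𝟎

∃-linearForm-true-at : ∀ {n} (w : V (suc n)) → isZero w ≡ false →
  ∃ λ φ → IsLinearForm φ × φ (true ∷ 𝟎 n) ≡ true × φ w ≡ true
∃-linearForm-true-at (true ∷ w)  _   = head , head-linear , refl , refl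
∃-linearForm-true-at (false ∷ w) w≢𝟎 =
  (λ v → head v xor selector w (tail v)) ,
  xor-linear head-linear (linearForm-∘ (selector-linear w) tail-⊕) ,
  cong not (linearForm-𝟎 (selector-linear w)) ,
  selector-self w w≢𝟎

∃-automorphism-sending-to : ∀ {n} (w : V (suc n)) → isZero w ≡ false →
  Σ (LinearEmbedding (suc n) (suc n)) λ f → Bijective _≡_ _≡_ (to f) × to f (true ∷ 𝟎 n) ≡ w
∃-automorphism-sending-to {n} w w≢𝟎 with ∃-linearForm-true-at w w≢𝟎
... | φ , φ-lin , φu , φw =
  transvectionₗ φ-lin (u ⊕ w) φ[u⊕w]≡false ,
  involution⇒bijective (transvection-involutive φ-lin (u ⊕ w) φ[u⊕w]≡false) ,
  trans (cong (λ b → u ⊕ scale b (u ⊕ w)) φu) (⊕.cancelˡ u w)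
  where
  u = true ∷ 𝟎 n
  φ[u⊕w]≡false = trans (⊕-homo φ-lin u w) (cong₂ _xor_ φu φw)

parity-nonzero : ∀ n → parity (suc n) (not ∘ isZero) ≡ true
parity-nonzero zero    = refl
parity-nonzero (suc n) = cong₂ _xor_ (parity-nonzero n) (xor-same (parity n (λ _ → true)))

not∧not≡true : ∀ {a b} → not a ∧ not b ≡ true → a ≡ false × b ≡ false
not∧not≡true {false} {false} _ = refl , refl

parity-complement : ∀ {n} (M : Mat (suc n)) →
  parity (suc n) (λ v → not (isZero v) ∧ not (E M v)) ≡ not (parity (suc n) (E M))
parity-complement {n} M =
  trans (parity-cong (suc n) complement)
        (trans (parity-xor (suc n) (not ∘ isZero) (E M))
               (cong (_xor parity (suc n) (E M)) (parity-nonzero n)))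
  where
  complement : ∀ v → not (isZero v) ∧ not (E M v) ≡ not (isZero v) xor E M v
  complement v with isZero v in z
  ... | true rewrite ==-sound v (𝟎 (suc n)) z | E-0 M = refl
  ... | false = refl

∃-nonzero-nonElement : ∀ {n} (M : Mat (suc n)) → EvenOnDim (suc n) (E M) →
  ∃ λ w → isZero w ≡ false × E M w ≡ false
∃-nonzero-nonElement {n} M even =
  let w , w∉M = parity-witness (suc n) (λ v → not (isZero v) ∧ not (E M v))
                               (trans (parity-complement M) (cong not (even idₗ)))
  in  w , not∧not≡true w∉M

TwistDecomposition : ℕ → ∀ {n} → Mat (suc n) → Set
TwistDecomposition k {n} M =
  Σ (Mat n) λ M₀ → Σ (Mat n) λ N → EvenAbove (suc k) (E M₀) × InClassE k N × Iso M (twist M₀ N)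

twist-decomposition-along : ∀ {n k} (M : Mat (suc n)) → EvenAbove (suc k) (E M) →
  (f : LinearEmbedding (suc n) (suc n)) → Bijective _≡_ _≡_ (to f) →
  E M (to f (true ∷ 𝟎 n)) ≡ false → TwistDecomposition k M
twist-decomposition-along {n} {k} M even f f-bij u∉M′ =
  pullback M′ false∷ₗ , fibre M′ u∉M′ ,
  evenAbove-∘ {P = E M′} false∷ₗ evenM′ ,
  Equivalence.from (inClassE⇔evenAbove k (fibre M′ u∉M′)) (evenAbove-fibreSum {P = E M′} evenM′) ,
  (to f , additive f , f-bij , twist-pullback-fibre M′ u∉M′)
  where
  M′ = pullback M f
  evenM′ = evenAbove-∘ {P = E M} f even

evenAbove⇒twistBuilt : ∀ k {n} (M : Mat n) → EvenAbove (suc k) (E M) → TwistBuilt (suc k) M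
evenAbove⇒twistBuilt k {zero}  M _ = base M z≤n
evenAbove⇒twistBuilt k {suc n} M even with suc n ≤? k
... | yes n<k = base M n<k
... | no  n≮k =
  let w , w≢𝟎 , w∉M              = ∃-nonzero-nonElement M (even (suc n) (≰⇒> n≮k))
      f , f-bij , fu≡w           = ∃-automorphism-sending-to w w≢𝟎
      M₀ , N , evenM₀ , N∈E , iso = twist-decomposition-along M even f f-bij
                                      (trans (cong (E M) fu≡w) w∉M)
  in  step (evenAbove⇒twistBuilt k M₀ evenM₀) N N∈E M iso

-- The argument works for every k ≥ 1; the hypothesis 2 ≤ k only rules out k = 0.
theorem3p2 : (k : ℕ) → 2 ≤ k → {n : ℕ} (M : Mat n) →
    (InClassE k M ⇔ EvenRestrictions k M) × (InClassE k M ⇔ TwistBuilt k M)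
theorem3p2 (suc k) _ M =
  mk⇔ (λ inE → inE (suc k) ≤-refl)
      (λ evenR → Equivalence.from (inClassE⇔evenAbove (suc k) M)
                   (evenOnDim⇒evenAbove {P = E M}
                     (Equivalence.to (evenRestrictions⇔evenOnDim (suc k) M) evenR))) ,
  mk⇔ (λ inE → evenAbove⇒twistBuilt k M (Equivalence.to (inClassE⇔evenAbove (suc k) M) inE))
      (λ built → Equivalence.from (inClassE⇔evenAbove (suc k) M) (twistBuilt⇒evenAbove built))
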